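{- Let $\le$ and $\preceq$ be partial orders on the same finite set $P$. Assume that for all $x,y\in P$ with $x\preceq y$, at least one of the following holds: (i) $x=y$; (ii) there exists $z\in P$ with $x<z\preceq y$; (iii) there exists $w\in P$ with $x\preceq w<y$. Then for all $x,y\in P$, $x\preceq y$ implies $x\le y$.
   Context: Here $<$ denotes the strict order associated with $\le$. -}

module Defs where

open import Level using (Level)
open import Data.Nat using (ℕ)
open import Data.Fin using (Fin)
open import Data.Product using (Σ; _×_)
open import Function.Bundles using (_↔_)
open import Relation.Binary.PropositionalEquality using (_≡_; _≢_)

IsFinite : ∀ {a} → Set a → Set a
IsFinite A = Σ ℕ (λ n → A ↔ Fin n)

Strict : ∀ {a ℓ} {A : Set a} → (A → A → Set ℓ) → A → A → Set _
Strict _≤_ x y = (x ≤ y) × (x ≢ y)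

{-# OPTIONS --safe #-}
-- On a finite set the strict order < is both well-founded and noetherian. Hence
-- shortening x ≼ y by strict <-steps at either end, as the hypothesis allows,
-- must end in an equality, and the steps taken compose to x ≤ y.
module Submission where

open import Defs
open import Data.Fin.Induction using (spo-wellFounded)
open import Data.Product using (Σ; _×_; _,_; proj₁)
open import Data.Sum using (_⊎_; inj₁; inj₂)
open import Function.Base using (flip)
open import Function.Bundles using (Inverse)
open import Induction.WellFounded using (WellFounded; Acc; acc; module Subrelation)
open import Relation.Binary.Core using (Rel)
open import Relation.Binary.PropositionalEquality using (_≡_; refl; sym; subst₂)
open import Relation.Binary.Structures using (IsPreorder; IsPartialOrder; IsStrictPartialOrder)
import Relation.Binary.Construct.Flip.EqAndOrd as Flip
import Relation.Binary.Construct.NonStrictToStrict as NonStrictToStrict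
import Relation.Binary.Construct.On as On

Reducible : ∀ {a ℓ₁ ℓ₂} {P : Set a} → Rel P ℓ₁ → Rel P ℓ₂ → Set _
Reducible {P = P} _≤_ _≼_ = ∀ x y → x ≼ y →
  (x ≡ y)
  ⊎ Σ P (λ z → Strict _≤_ x z × z ≼ y)
  ⊎ Σ P (λ w → x ≼ w × Strict _≤_ w y)

module _ {a} {A : Set a} where

  finite-spo-wellFounded : ∀ {ℓ} {_<_ : Rel A ℓ} → IsFinite A → IsStrictPartialOrder _≡_ _<_ →
                           WellFounded _<_
  finite-spo-wellFounded {_<_ = _<_} (_ , A↔Fin) isSPO =
    Subrelation.wellFounded <⇒<-on-round-trip
      (On.wellFounded to (spo-wellFounded (On.isStrictPartialOrder from isSPO)))
    where
    open Inverse A↔Fin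
    <⇒<-on-round-trip : ∀ {x y} → x < y → from (to x) < from (to y)
    <⇒<-on-round-trip = subst₂ _<_ (sym (strictlyInverseʳ _)) (sym (strictlyInverseʳ _))

  finite-spo-noetherian : ∀ {ℓ} {_<_ : Rel A ℓ} → IsFinite A → IsStrictPartialOrder _≡_ _<_ →
                          WellFounded (flip _<_)
  finite-spo-noetherian fin isSPO = finite-spo-wellFounded fin (Flip.isStrictPartialOrder isSPO)

module _ {a ℓ₁ ℓ₂} {P : Set a} {_≤_ : Rel P ℓ₁} {_≼_ : Rel P ℓ₂}
         (≤-isPreorder : IsPreorder _≡_ _≤_) (reducible : Reducible _≤_ _≼_) where

  open IsPreorder ≤-isPreorder using (trans) renaming (refl to ≤-refl)

  -- Shortening x ≼ y at the left end moves x up, at the right end moves y down;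
  -- the recursion is lexicographic in the two accessibility proofs.
  reducible⇒⊆-acc : ∀ {x y} → Acc (flip (Strict _≤_)) x → Acc (Strict _≤_) y → x ≼ y → x ≤ y
  reducible⇒⊆-acc {x} {y} (acc above) (acc below) x≼y with reducible x y x≼y
  ... | inj₁ refl                   = ≤-refl
  ... | inj₂ (inj₁ (z , x<z , z≼y)) = trans (proj₁ x<z) (reducible⇒⊆-acc (above x<z) (acc below) z≼y)
  ... | inj₂ (inj₂ (w , x≼w , w<y)) = trans (reducible⇒⊆-acc (acc above) (below w<y) x≼w) (proj₁ w<y)

  reducible⇒⊆ : WellFounded (flip (Strict _≤_)) → WellFounded (Strict _≤_) →
                ∀ {x y} → x ≼ y → x ≤ y
  reducible⇒⊆ noetherian wellFounded {x} {y} = reducible⇒⊆-acc (noetherian x) (wellFounded y)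

lemma3p4 : ∀ {a ℓ₁ ℓ₂} {P : Set a} (_≤_ : P → P → Set ℓ₁) (_≼_ : P → P → Set ℓ₂) →
    IsFinite P →
    IsPartialOrder _≡_ _≤_ →
    IsPartialOrder _≡_ _≼_ →
    (∀ x y → x ≼ y →
      (x ≡ y)
      ⊎ Σ P (λ z → Strict _≤_ x z × z ≼ y)
      ⊎ Σ P (λ w → x ≼ w × Strict _≤_ w y)) →
    ∀ x y → x ≼ y → x ≤ y
lemma3p4 _≤_ _≼_ fin ≤-isPartialOrder _ reducible x y =
  reducible⇒⊆ (IsPartialOrder.isPreorder ≤-isPartialOrder) reducible
    (finite-spo-noetherian fin <-isSPO) (finite-spo-wellFounded fin <-isSPO)
  where
  <-isSPO : IsStrictPartialOrder _≡_ (Strict _≤_)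
  <-isSPO = NonStrictToStrict.<-isStrictPartialOrder _≡_ _≤_ ≤-isPartialOrder
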